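{- $\mathbf{mCi}$ is not axiomatizable by a finite Set-Fmla H-system: there is no Set-Fmla H-system $\mathcal{H}$ with finitely many rule schemas such that $\vdash_{\mathcal{H}}\;=\;\vdash_{\mathbf{mCi}}$.
   Context: Let $\Sigma$ be the propositional signature with unary connectives $\neg,\circ$ and binary connectives $\land,\lor,\to$, and let $L$ be the set of $\Sigma$-formulas over a denumerable set $P$ of propositional variables. A (schematic) Set-Fmla Hilbert-style system is a collection of rule schemas $\Gamma/\varphi$ (with finite $\Gamma$; axioms have $\Gamma=\varnothing$), each rule consisting of all substitution instances of its schema; $\Gamma \vdash_{\mathcal{H}} \varphi$ holds iff there is a finite sequence of formulas ending in $\varphi$ each of which belongs to $\Gamma$ or is the conclusion of a rule instance whose premises occur earlier. Fix a Set-Fmla H-system for positive classical logic (the $\{\land,\lor,\to\}$-fragment of classical logic). For $j\in\omega$, $\neg^j$ denotes $j$-fold application of $\neg$. The logic $\mathbf{mCi}$ is the consequence relation $\vdash_{\mathbf{mCi}}$ of the system extending the positive classical system with the axiom schemas (Ax10) $p\lor\neg p$; (bc1) $\circ p\to(p\to(\neg p\to q))$; (ci) $\neg\circ p\to(p\land\neg p)$; and (cc)$_j$ $\circ\neg^j\circ p$ for every $j\in\omega$. -}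

module Defs where

open import Data.Nat using (ℕ; zero; suc)
open import Data.List using (List; []; _∷_; map)
open import Data.List.Relation.Unary.All using (All)
open import Data.List.Membership.Propositional using (_∈_)
open import Data.Product using (_×_)

infixr 5 _⇒_
infixr 6 _∨_
infixr 7 _∧_
data Fm : Set where
  var : ℕ → Fm
  ~_  : Fm → Fm
  ∘_  : Fm → Fm
  _∧_ : Fm → Fm → Fm
  _∨_ : Fm → Fm → Fm
  _⇒_ : Fm → Fm → Fm

Subst : Set
Subst = ℕ → Fm

sub : Subst → Fm → Fm
sub σ (var n) = σ n
sub σ (~ φ)   = ~ sub σ φ
sub σ (∘ φ)   = ∘ sub σ φ
sub σ (φ ∧ ψ) = sub σ φ ∧ sub σ ψ
sub σ (φ ∨ ψ) = sub σ φ ∨ sub σ ψ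
sub σ (φ ⇒ ψ) = sub σ φ ⇒ sub σ ψ

record Rule : Set where
  constructor _/_
  field
    premises   : List Fm
    conclusion : Fm
open Rule public

axiom : Fm → Rule
axiom φ = [] / φ

HSystem : Set₁
HSystem = Rule → Set

-- Derivability Γ ⊢_H φ for arbitrary sets Γ ⊆ L (inductive presentation of
-- finite derivation sequences): φ is a premise, or the conclusion of a
-- substitution instance of a rule of H whose instantiated premises are derivable.
data _⊢[_]_ (Γ : Fm → Set) (H : HSystem) : Fm → Set where
  assume : ∀ {φ} → Γ φ → Γ ⊢[ H ] φ
  apply  : ∀ {r} → H r → (σ : Subst) →
           All (Γ ⊢[ H ]_) (map (sub σ) (premises r)) →
           Γ ⊢[ H ] sub σ (conclusion r)

finiteSystem : List Rule → HSystem
finiteSystem rs r = r ∈ rs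

SameConsequence : HSystem → HSystem → Set₁
SameConsequence H H' = ∀ (Γ : Fm → Set) (φ : Fm) →
  (Γ ⊢[ H ] φ → Γ ⊢[ H' ] φ) × (Γ ⊢[ H' ] φ → Γ ⊢[ H ] φ)

p q r : Fm
p = var 0
q = var 1
r = var 2

CPL⁺ : List Rule
CPL⁺ =
    axiom (p ⇒ (q ⇒ p))
  ∷ axiom ((p ⇒ q) ⇒ ((p ⇒ (q ⇒ r)) ⇒ (p ⇒ r)))
  ∷ axiom (p ⇒ (q ⇒ (p ∧ q)))
  ∷ axiom ((p ∧ q) ⇒ p)
  ∷ axiom ((p ∧ q) ⇒ q)
  ∷ axiom (p ⇒ (p ∨ q))
  ∷ axiom (q ⇒ (p ∨ q))
  ∷ axiom ((p ⇒ r) ⇒ ((q ⇒ r) ⇒ ((p ∨ q) ⇒ r)))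
  ∷ axiom (p ∨ (p ⇒ q))
  ∷ ((p ∷ (p ⇒ q) ∷ []) / q)
  ∷ []

¬^ : ℕ → Fm → Fm
¬^ zero    φ = φ
¬^ (suc j) φ = ~ (¬^ j φ)

data mCi : HSystem where
  pos  : ∀ {ρ} → ρ ∈ CPL⁺ → mCi ρ
  ax10 : mCi (axiom (p ∨ ~ p))
  bc1  : mCi (axiom (∘ p ⇒ (p ⇒ (~ p ⇒ q))))
  ci   : mCi (axiom (~ ∘ p ⇒ (p ∧ ~ p)))
  cc   : ∀ j → mCi (axiom (∘ (¬^ j (∘ p))))

-- For each N there is a logical matrix 𝕄 N in which every rule of mCi is valid except the
-- axioms cc_j with j > N.  Its values carry, besides a truth value, a "fuel" counter: negation
-- acts classically while fuel remains and, once it is exhausted, returns a designated value.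
-- Derivations are finite, so any finitely many rules derivable in mCi are already derivable
-- from the instances cc_j with j ≤ N for a single N, hence are valid in 𝕄 N.  If such finitely
-- many rules axiomatised mCi, then cc_(N+1) would be valid in 𝕄 N, which it is not.
module Submission where

open import Defs
open import Data.Bool using (Bool; true; false; not; T) renaming (_∧_ to _∧ᵇ_; _∨_ to _∨ᵇ_)
open import Data.Bool.Properties using (T-≡; T-∧; not-involutive; ∧-identityʳ; ∧-inverseʳ)
open import Data.Empty using (⊥)
open import Data.List using (List; []; _∷_; map)
open import Data.List.Membership.Propositional using (_∈_)
open import Data.List.Relation.Unary.All as All using (All; []; _∷_)
open import Data.List.Relation.Unary.All.Properties using (map⁻)
open import Data.List.Relation.Unary.Any using (here; there)
open import Data.Nat using (ℕ; zero; suc; _+_; _≤_; _⊔_)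
open import Data.Nat.GeneralisedArithmetic using (fold)
open import Data.Nat.Properties using (+-suc; +-comm; +-identityʳ; m≤m⊔n; m≤n⊔m; ≤-trans; m≤n⇒∃[o]m+o≡n)
open import Data.Product using (Σ; ∃; _,_; proj₁; proj₂)
open import Function using (Equivalence; _∘′_)
open import Relation.Binary.PropositionalEquality
  using (_≡_; refl; sym; trans; cong; cong₂; subst; module ≡-Reasoning)
open import Relation.Nullary using (¬_)
open import Relation.Unary using (∅; _⊆_)

private
  variable
    Γ : Fm → Set
    H H′ : HSystem
    φ : Fm
    ρ : Rule

⊢-induction : (P : Fm → Set) →
              (∀ {ψ} → Γ ψ → P ψ) →
              (∀ {r} → H r → ∀ σ → All P (map (sub σ) (premises r)) → P (sub σ (conclusion r))) →
              Γ ⊢[ H ] φ → P φ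
⊢-induction {Γ = Γ} {H = H} P base step = go
  where
  mutual
    go : ∀ {φ} → Γ ⊢[ H ] φ → P φ
    go (assume γ)      = base γ
    go (apply h σ ds) = step h σ (goAll ds)

    goAll : ∀ {ψs} → All (Γ ⊢[ H ]_) ψs → All P ψs
    goAll []       = []
    goAll (d ∷ ds) = go d ∷ goAll ds

⊢-mono : (∀ {r} → H r → H′ r) → Γ ⊢[ H ] φ → Γ ⊢[ H′ ] φ
⊢-mono H⊆H′ = ⊢-induction _ assume (λ h σ → apply (H⊆H′ h) σ)

sub-id : ∀ φ → sub var φ ≡ φ
sub-id (var n) = refl
sub-id (~ φ)   = cong ~_ (sub-id φ)
sub-id (∘ φ)   = cong ∘_ (sub-id φ)
sub-id (φ ∧ ψ) = cong₂ _∧_ (sub-id φ) (sub-id ψ)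
sub-id (φ ∨ ψ) = cong₂ _∨_ (sub-id φ) (sub-id ψ)
sub-id (φ ⇒ ψ) = cong₂ _⇒_ (sub-id φ) (sub-id ψ)

Premises : Rule → Fm → Set
Premises r ψ = ψ ∈ premises r

derive-rule : H ρ → Premises ρ ⊆ Γ → Γ ⊢[ H ] conclusion ρ
derive-rule {ρ = ps / φ} h Γ⊇ps =
  subst (_ ⊢[ _ ]_) (sub-id φ) (apply h var (assumeAll ps Γ⊇ps))
  where
  assumeAll : ∀ ps → (∀ {ψ} → ψ ∈ ps → Γ ψ) → All (Γ ⊢[ H ]_) (map (sub var) ps)
  assumeAll []       _     = []
  assumeAll (ψ ∷ ps) Γ⊇ψps =
    subst (_ ⊢[ _ ]_) (sym (sub-id ψ)) (assume (Γ⊇ψps (here refl)))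
      ∷ assumeAll ps (λ ψ∈ps → Γ⊇ψps (there ψ∈ps))

uniform-bound : {A : Set} (P : ℕ → A → Set) →
                (∀ {m n x} → m ≤ n → P m x → P n x) →
                ∀ {xs} → All (λ x → ∃ λ n → P n x) xs → ∃ λ n → All (P n) xs
uniform-bound P P-mono []               = 0 , []
uniform-bound P P-mono ((m , px) ∷ pxs) with uniform-bound P P-mono pxs
... | n , pxs′ = m ⊔ n , P-mono (m≤m⊔n m n) px ∷ All.map (P-mono (m≤n⊔m m n)) pxs′

module _ (rank : ∀ {r} → H r → ℕ) where

  RankBounded : ℕ → HSystem
  RankBounded N r = Σ (H r) λ h → rank h ≤ N

  ⊢-RankBounded-mono : ∀ {m n} → m ≤ n → Γ ⊢[ RankBounded m ] φ → Γ ⊢[ RankBounded n ] φ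
  ⊢-RankBounded-mono m≤n = ⊢-mono λ (h , h≤m) → h , ≤-trans h≤m m≤n

  ⊢-rankBounded : Γ ⊢[ H ] φ → ∃ λ N → Γ ⊢[ RankBounded N ] φ
  ⊢-rankBounded {Γ = Γ} = ⊢-induction _ (λ γ → 0 , assume γ) step
    where
    step : ∀ {r} → H r → ∀ σ → All (λ ψ → ∃ λ N → Γ ⊢[ RankBounded N ] ψ) (map (sub σ) (premises r)) →
           ∃ λ N → Γ ⊢[ RankBounded N ] sub σ (conclusion r)
    step h σ ds with uniform-bound (λ N ψ → Γ ⊢[ RankBounded N ] ψ) ⊢-RankBounded-mono ds
    ... | N , ds′ = rank h ⊔ N ,
      apply (h , m≤m⊔n (rank h) N) σ (All.map (⊢-RankBounded-mono (m≤n⊔m (rank h) N)) ds′)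

record Matrix : Set₁ where
  field
    Carrier         : Set
    Designated      : Carrier → Set
    ¬ᴹ ∘ᴹ           : Carrier → Carrier
    _∧ᴹ_ _∨ᴹ_ _⇒ᴹ_ : Carrier → Carrier → Carrier

module Semantics (M : Matrix) where
  open Matrix M

  Valuation : Set
  Valuation = ℕ → Carrier

  ⟦_⟧ : Fm → Valuation → Carrier
  ⟦ var n ⟧ w = w n
  ⟦ ~ φ ⟧   w = ¬ᴹ (⟦ φ ⟧ w)
  ⟦ ∘ φ ⟧   w = ∘ᴹ (⟦ φ ⟧ w)
  ⟦ φ ∧ ψ ⟧ w = ⟦ φ ⟧ w ∧ᴹ ⟦ ψ ⟧ w
  ⟦ φ ∨ ψ ⟧ w = ⟦ φ ⟧ w ∨ᴹ ⟦ ψ ⟧ w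
  ⟦ φ ⇒ ψ ⟧ w = ⟦ φ ⟧ w ⇒ᴹ ⟦ ψ ⟧ w

  ⟦_⟧ˢ : Subst → Valuation → Valuation
  ⟦ σ ⟧ˢ w n = ⟦ σ n ⟧ w

  ⟦sub⟧ : ∀ σ φ w → ⟦ sub σ φ ⟧ w ≡ ⟦ φ ⟧ (⟦ σ ⟧ˢ w)
  ⟦sub⟧ σ (var n) w = refl
  ⟦sub⟧ σ (~ φ)   w = cong ¬ᴹ (⟦sub⟧ σ φ w)
  ⟦sub⟧ σ (∘ φ)   w = cong ∘ᴹ (⟦sub⟧ σ φ w)
  ⟦sub⟧ σ (φ ∧ ψ) w = cong₂ _∧ᴹ_ (⟦sub⟧ σ φ w) (⟦sub⟧ σ ψ w)
  ⟦sub⟧ σ (φ ∨ ψ) w = cong₂ _∨ᴹ_ (⟦sub⟧ σ φ w) (⟦sub⟧ σ ψ w)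
  ⟦sub⟧ σ (φ ⇒ ψ) w = cong₂ _⇒ᴹ_ (⟦sub⟧ σ φ w) (⟦sub⟧ σ ψ w)

  ⟦¬^⟧ : ∀ j φ w → ⟦ ¬^ j φ ⟧ w ≡ fold (⟦ φ ⟧ w) ¬ᴹ j
  ⟦¬^⟧ zero    φ w = refl
  ⟦¬^⟧ (suc j) φ w = cong ¬ᴹ (⟦¬^⟧ j φ w)

  _⊨_ : Valuation → Fm → Set
  w ⊨ φ = Designated (⟦ φ ⟧ w)

  Valid : Rule → Set
  Valid r = ∀ w → All (w ⊨_) (premises r) → w ⊨ conclusion r

  sound : (∀ {r} → H r → Valid r) → Γ ⊢[ H ] φ → ∀ w → (∀ {ψ} → Γ ψ → w ⊨ ψ) → w ⊨ φ
  sound {H = H} valid d w w⊨Γ = ⊢-induction (w ⊨_) w⊨Γ step d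
    where
    step : ∀ {r} → H r → ∀ σ → All (w ⊨_) (map (sub σ) (premises r)) → w ⊨ sub σ (conclusion r)
    step {r} h σ w⊨prems =
      subst Designated (sym (⟦sub⟧ σ (conclusion r) w))
        (valid h (⟦ σ ⟧ˢ w) (All.map (λ {ψ} → subst Designated (⟦sub⟧ σ ψ w)) (map⁻ w⊨prems)))

  derived-rule-valid : (∀ {r} → H r → Valid r) → Premises ρ ⊢[ H ] conclusion ρ → Valid ρ
  derived-rule-valid valid d w w⊨prems = sound valid d w (All.lookup w⊨prems)

∀ᵇ : (Bool → Bool) → Bool
∀ᵇ f = f true ∧ᵇ f false

T-∀ᵇ : ∀ f → T (∀ᵇ f) → ∀ a → T (f a)
T-∀ᵇ f ok true  = proj₁ (Equivalence.to T-∧ ok)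
T-∀ᵇ f ok false = proj₂ (Equivalence.to T-∧ ok)

𝔹 : Matrix
𝔹 = record
  { Carrier    = Bool
  ; Designated = λ b → b ≡ true
  ; ¬ᴹ         = not
  ; ∘ᴹ         = λ _ → true
  ; _∧ᴹ_       = _∧ᵇ_
  ; _∨ᴹ_       = _∨ᵇ_
  ; _⇒ᴹ_       = λ a b → not a ∨ᵇ b
  }

pqr : Bool → Bool → Bool → ℕ → Bool
pqr a b c 0 = a
pqr a b c 1 = b
pqr a b c 2 = c
pqr a b c (suc (suc (suc _))) = false

open Semantics 𝔹 using () renaming (⟦_⟧ to ⟦_⟧ᴮ)

Tautology : Fm → Set
Tautology φ = T (∀ᵇ λ a → ∀ᵇ λ b → ∀ᵇ λ c → ⟦ φ ⟧ᴮ (pqr a b c))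

tautology : ∀ φ → Tautology φ → ∀ a b c → ⟦ φ ⟧ᴮ (pqr a b c) ≡ true
tautology φ ok a b c =
  Equivalence.to T-≡ (T-∀ᵇ (f a b) (T-∀ᵇ (∀ᵇ ∘′ f a) (T-∀ᵇ (λ a → ∀ᵇ (∀ᵇ ∘′ f a)) ok a) b) c)
  where
  f : Bool → Bool → Bool → Bool
  f a b c = ⟦ φ ⟧ᴮ (pqr a b c)

record Val : Set where
  constructor val
  field
    truth : Bool
    fuel  : ℕ
open Val

neg : Val → Val
neg (val b (suc k)) = val (not b) k
neg (val b zero)    = val true zero

neg-fold : ∀ j b k → fold (val b (k + j)) neg j ≡ val (fold b not j) k
neg-fold zero    b k = cong (val b) (+-identityʳ k)
neg-fold (suc j) b k = begin
  neg (fold (val b (k + suc j)) neg j)  ≡⟨ cong (λ n → neg (fold (val b n) neg j)) (+-suc k j) ⟩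
  neg (fold (val b (suc k + j)) neg j)  ≡⟨ cong neg (neg-fold j b (suc k)) ⟩
  val (fold b not (suc j)) k            ∎
  where open ≡-Reasoning

fold-not-surjective : ∀ j b → ∃ λ c → fold c not j ≡ b
fold-not-surjective zero    b = b , refl
fold-not-surjective (suc j) b with fold-not-surjective j (not b)
... | c , c↦¬b = c , trans (cong not c↦¬b) (not-involutive b)

neg-excluded-middle : ∀ x → truth x ∨ᵇ truth (neg x) ≡ true
neg-excluded-middle (val true  _)       = refl
neg-excluded-middle (val false zero)    = refl
neg-excluded-middle (val false (suc _)) = refl

-- The other connectives produce full fuel N+1, so ¬^j applied to them stays classical
-- exactly for j ≤ N.
𝕄 : ℕ → Matrix
𝕄 N = record
  { Carrier    = Val
  ; Designated = λ x → truth x ≡ true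
  ; ¬ᴹ         = neg
  ; ∘ᴹ         = λ x → full (not (truth x ∧ᵇ truth (neg x)))
  ; _∧ᴹ_       = λ x y → full (truth x ∧ᵇ truth y)
  ; _∨ᴹ_       = λ x y → full (truth x ∨ᵇ truth y)
  ; _⇒ᴹ_       = λ x y → full (not (truth x) ∨ᵇ truth y)
  }
  where
  full : Bool → Val
  full b = val b (suc N)

tautology-in-𝕄 : ∀ φ → Tautology φ → (w : ℕ → Val) →
                 ⟦ φ ⟧ᴮ (pqr (truth (w 0)) (truth (w 1)) (truth (w 2))) ≡ true
tautology-in-𝕄 φ ok w = tautology φ ok (truth (w 0)) (truth (w 1)) (truth (w 2))

module _ (N : ℕ) where
  open Semantics (𝕄 N) using (⟦_⟧; ⟦¬^⟧; Valid)
  open Matrix (𝕄 N) using (∘ᴹ)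

  -- The positive connectives of 𝕄 N compute truth values as 𝔹 does, so each axiom's goal is
  -- definitionally its value in 𝔹.
  CPL⁺-valid : ρ ∈ CPL⁺ → Valid ρ
  CPL⁺-valid {ρ} (here refl) w _ = tautology-in-𝕄 (conclusion ρ) _ w
  CPL⁺-valid {ρ} (there (here refl)) w _ = tautology-in-𝕄 (conclusion ρ) _ w
  CPL⁺-valid {ρ} (there (there (here refl))) w _ = tautology-in-𝕄 (conclusion ρ) _ w
  CPL⁺-valid {ρ} (there (there (there (here refl)))) w _ = tautology-in-𝕄 (conclusion ρ) _ w
  CPL⁺-valid {ρ} (there (there (there (there (here refl))))) w _ = tautology-in-𝕄 (conclusion ρ) _ w
  CPL⁺-valid {ρ} (there (there (there (there (there (here refl)))))) w _ = tautology-in-𝕄 (conclusion ρ) _ w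
  CPL⁺-valid {ρ} (there (there (there (there (there (there (here refl))))))) w _ = tautology-in-𝕄 (conclusion ρ) _ w
  CPL⁺-valid {ρ} (there (there (there (there (there (there (there (here refl)))))))) w _ = tautology-in-𝕄 (conclusion ρ) _ w
  CPL⁺-valid {ρ} (there (there (there (there (there (there (there (there (here refl))))))))) w _ = tautology-in-𝕄 (conclusion ρ) _ w
  CPL⁺-valid (there (there (there (there (there (there (there (there (there (here refl)))))))))) w
    (w⊨p ∷ w⊨p⇒q ∷ []) = subst (λ a → not a ∨ᵇ truth (w 1) ≡ true) w⊨p w⊨p⇒q

  cc-valid : ∀ {j} → j ≤ N → Valid (axiom (∘ (¬^ j (∘ p))))
  cc-valid {j} j≤N w [] with m≤n⇒∃[o]m+o≡n j≤N
  ... | k , refl = begin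
    truth (∘ᴹ (⟦ ¬^ j (∘ p) ⟧ w))           ≡⟨ cong (truth ∘′ ∘ᴹ) ¬^j∘p≡ ⟩
    not (fold c not j ∧ᵇ not (fold c not j)) ≡⟨ cong not (∧-inverseʳ (fold c not j)) ⟩
    true                                     ∎
    where
    open ≡-Reasoning
    c = truth (⟦ ∘ p ⟧ w)
    ¬^j∘p≡ : ⟦ ¬^ j (∘ p) ⟧ w ≡ val (fold c not j) (suc k)
    ¬^j∘p≡ = begin
      ⟦ ¬^ j (∘ p) ⟧ w                 ≡⟨ ⟦¬^⟧ j (∘ p) w ⟩
      fold (val c (suc (j + k))) neg j ≡⟨ cong (λ n → fold (val c (suc n)) neg j) (+-comm j k) ⟩
      fold (val c (suc k + j)) neg j   ≡⟨ neg-fold j c (suc k) ⟩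
      val (fold c not j) (suc k)       ∎

  ∘-attains : ∀ c → truth (⟦ ∘ p ⟧ (λ _ → val (not c) 0)) ≡ c
  ∘-attains c = trans (cong not (∧-identityʳ (not c))) (not-involutive c)

  cc-invalid : ¬ Valid (axiom (∘ (¬^ (suc N) (∘ p))))
  cc-invalid valid with fold-not-surjective (suc N) true
  ... | c , c↦true = false≢true (trans (sym (cong (truth ∘′ ∘ᴹ) ¬^N+1∘p≡)) (valid w []))
    where
    open ≡-Reasoning
    w : ℕ → Val
    w _ = val (not c) 0
    c′ = truth (⟦ ∘ p ⟧ w)
    ¬^N+1∘p≡ : ⟦ ¬^ (suc N) (∘ p) ⟧ w ≡ val true 0
    ¬^N+1∘p≡ = begin
      ⟦ ¬^ (suc N) (∘ p) ⟧ w          ≡⟨ ⟦¬^⟧ (suc N) (∘ p) w ⟩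
      fold (val c′ (suc N)) neg (suc N) ≡⟨ neg-fold (suc N) c′ 0 ⟩
      val (fold c′ not (suc N)) 0       ≡⟨ cong (λ b → val (fold b not (suc N)) 0) (∘-attains c) ⟩
      val (fold c not (suc N)) 0        ≡⟨ cong (λ b → val b 0) c↦true ⟩
      val true 0                        ∎
    false≢true : false ≡ true → ⊥
    false≢true ()

ccIndex : mCi ρ → ℕ
ccIndex (cc j) = j
ccIndex _      = 0

mCi≤ : ℕ → HSystem
mCi≤ = RankBounded {H = mCi} ccIndex

-- In 𝕄 N the truth of ∘ φ is that of ~ (φ ∧ ~ φ), and only the truth of ~ p is not classical:
-- bc1 and ci are instances of classical tautologies with r standing for ~ p.
mCi≤-valid : ∀ N → mCi≤ N ρ → Semantics.Valid (𝕄 N) ρ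
mCi≤-valid N (pos ρ∈CPL⁺ , _) = CPL⁺-valid N ρ∈CPL⁺
mCi≤-valid N (ax10 , _) w _ = neg-excluded-middle (w 0)
mCi≤-valid N (bc1 , _) w _ =
  tautology (~ (p ∧ r) ⇒ (p ⇒ (r ⇒ q))) _ (truth (w 0)) (truth (w 1)) (truth (neg (w 0)))
mCi≤-valid N (ci , _) w _ =
  tautology (~ ~ (p ∧ r) ⇒ (p ∧ r)) _ (truth (w 0)) (truth (w 1)) (truth (neg (w 0)))
mCi≤-valid N (cc j , j≤N) = cc-valid N j≤N

theorem2 : ¬ (Σ (List Rule) λ H → SameConsequence (finiteSystem H) mCi)
theorem2 (rs , same) = cc-invalid N λ w _ → Semantics.sound (𝕄 N) rs-valid cc-in-rs w λ ()
  where
  in-mCi≤ : ∃ λ N → All (λ ρ → Premises ρ ⊢[ mCi≤ N ] conclusion ρ) rs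
  in-mCi≤ = uniform-bound _ (⊢-RankBounded-mono ccIndex)
    (All.tabulate λ ρ∈rs → ⊢-rankBounded ccIndex (proj₁ (same _ _) (derive-rule ρ∈rs λ ψ∈ → ψ∈)))
  N = proj₁ in-mCi≤
  rs-valid : ∀ {ρ} → ρ ∈ rs → Semantics.Valid (𝕄 N) ρ
  rs-valid ρ∈rs = Semantics.derived-rule-valid (𝕄 N) (mCi≤-valid N) (All.lookup (proj₂ in-mCi≤) ρ∈rs)
  cc-in-rs : ∅ ⊢[ finiteSystem rs ] (∘ (¬^ (suc N) (∘ p)))
  cc-in-rs = proj₂ (same _ _) (derive-rule (cc (suc N)) λ ())
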